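{- For every $n\ge0$ and every $\pi\in S_n(132)$, $$\bigl(D(\pi^{ -1}),\,E(\pi^{ -1}),\,\mathsf{des}(\pi^{ -1})\bigr)=\bigl(E(\pi),\,D(\pi),\,\mathsf{des}(\pi)\bigr).$$
   Context: $S_n$ is the set of permutations of $\{1,\dots,n\}$ in one-line notation $\pi=\pi_1\cdots\pi_n$; $S_n(132)$ those avoiding the classical pattern $132$ (no $i<j<k$ with $\pi_i<\pi_k<\pi_j$). $\pi^{ -1}$ is the inverse permutation ($\pi^{ -1}_{\pi_i}=i$). Statistics: $\mathsf{des}(\pi)=\mathrm{card}\{i<n:\pi_i>\pi_{i+1}\}$; $D(\pi)=\mathrm{card}\{(i,k):1\le i,\ i+1<k\le n,\ \pi_k<\pi_i<\pi_{i+1}\}$ (occurrences of the vincular pattern $\underline{23}\text{ - }1$); $E(\pi)=\mathrm{card}\{(i,j):1\le i<j\le n-1,\ \pi_j<\pi_{j+1}<\pi_i\}$ (occurrences of the vincular pattern $3\text{ - }\underline{12}$). -}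

module Defs where

open import Data.Nat using (ℕ; suc; _<_; _<?_)
open import Data.Nat.Properties using ()
open import Data.Fin using (Fin; toℕ)
open import Data.Fin.Permutation using (Permutation′; _⟨$⟩ʳ_)
open import Data.List using (List; allFin; filter; length; cartesianProduct)
open import Data.Product using (_×_; _,_; ∃-syntax)
open import Relation.Nullary using (¬_; Dec; _×-dec_)
open import Relation.Unary using (Decidable)

-- Positions 1..n are represented by Fin n (position i ↔ toℕ i + 1);
-- values likewise.  Comparisons are done on toℕ.

val : ∀ {n} → Permutation′ n → Fin n → ℕ
val π i = toℕ (π ⟨$⟩ʳ i)

count : ∀ {A : Set} {P : A → Set} → Decidable P → List A → ℕ
count P? xs = length (filter P? xs)

pairs : ∀ n → List (Fin n × Fin n)
pairs n = cartesianProduct (allFin n) (allFin n)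

des : ∀ {n} → Permutation′ n → ℕ
des {n} π = count P? (pairs n)
  where
  open import Relation.Binary.PropositionalEquality using (_≡_)
  P : Fin n × Fin n → Set
  P (i , j) = (suc (toℕ i) ≡ toℕ j) × (val π j < val π i)
  P? : Decidable P
  P? (i , j) = (suc (toℕ i) Data.Nat.≟ toℕ j) ×-dec (val π j <? val π i)

-- D(π): pairs (i,k), i+1 < k, with π_k < π_i < π_{i+1}  (pattern 23-1)
-- encoded as triples (i, j, k) with j = i+1, j < k.
triples : ∀ n → List (Fin n × Fin n × Fin n)
triples n = cartesianProduct (allFin n) (pairs n)

D : ∀ {n} → Permutation′ n → ℕ
D {n} π = count P? (triples n)
  where
  open import Relation.Binary.PropositionalEquality using (_≡_)
  P : Fin n × Fin n × Fin n → Set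
  P (i , j , k) = (suc (toℕ i) ≡ toℕ j) × (toℕ j < toℕ k)
                  × (val π k < val π i) × (val π i < val π j)
  P? : Decidable P
  P? (i , j , k) = (suc (toℕ i) Data.Nat.≟ toℕ j) ×-dec (toℕ j <? toℕ k)
                   ×-dec (val π k <? val π i) ×-dec (val π i <? val π j)

-- E(π): pairs (i,j), i < j, j+1 ≤ n, with π_j < π_{j+1} < π_i  (pattern 3-12)
-- encoded as triples (i, j, l) with l = j+1, i < j.
E : ∀ {n} → Permutation′ n → ℕ
E {n} π = count P? (triples n)
  where
  open import Relation.Binary.PropositionalEquality using (_≡_)
  P : Fin n × Fin n × Fin n → Set
  P (i , j , l) = (toℕ i < toℕ j) × (suc (toℕ j) ≡ toℕ l)
                  × (val π j < val π l) × (val π l < val π i)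
  P? : Decidable P
  P? (i , j , l) = (toℕ i <? toℕ j) ×-dec (suc (toℕ j) Data.Nat.≟ toℕ l)
                   ×-dec (val π j <? val π l) ×-dec (val π l <? val π i)

Contains132 : ∀ {n} → Permutation′ n → Set
Contains132 {n} π = ∃[ i ] ∃[ j ] ∃[ k ]
  (toℕ i < toℕ j) × (toℕ j < toℕ k) × (val π i < val π k) × (val π k < val π j)

Avoids132 : ∀ {n} → Permutation′ n → Set
Avoids132 π = ¬ Contains132 π

-- The heart of the proof is one structural fact about 132-avoiders: if
-- positions j, j+1 form an ascent of π with top value v = π(j+1), then the
-- value v−1 occurs at a position π⁻¹(v−1) < j+1 (otherwise π(j), π(j+1), v−1
-- would be a 132).  Hence (j, j+1) ↦ (v−1, v) sends ascents of π to ascents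
-- of π⁻¹, and the same map for π⁻¹ undoes it.
--
-- An occurrence (i, j, j+1) of 3-12 in π has an ascent at (j, j+1); sending
-- it to (v−1, v, π(i)) gives an occurrence of 23-1 in π⁻¹ (132-avoidance also
-- forces i < π⁻¹(v−1)), and the inverse map is built the same way from π⁻¹.
-- So E(π) = D(π⁻¹), and applying this to π⁻¹ (again 132-avoiding) gives
-- E(π⁻¹) = D(π).  Ascents being equinumerous, descents are too, since
-- descents and ascents partition the adjacent pairs.
module Submission where

open import Data.Empty using (⊥-elim)
open import Data.Fin using (Fin; toℕ; pred; suc)
open import Data.Fin.Permutation using (Permutation′; flip; _⟨$⟩ʳ_; _⟨$⟩ˡ_; inverseˡ; inverseʳ)
open import Data.Fin.Properties using (toℕ-injective; toℕ-inject₁; _≟_)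
open import Data.List using (List; []; _∷_; filter; length)
open import Data.List.Membership.Propositional using (_∈_)
open import Data.List.Membership.Propositional.Properties using (∈-filter⁺; ∈-cartesianProduct⁺; ∈-allFin)
open import Data.List.Properties using (filter-notAll)
open import Data.List.Relation.Unary.All using (lookup)
import Data.List.Relation.Unary.Any as Any
open import Data.List.Relation.Unary.Any using (here; there)
open import Data.List.Relation.Unary.Unique.Propositional using (Unique; _∷_)
open import Data.List.Relation.Unary.Unique.Propositional.Properties using (cartesianProduct⁺; allFin⁺)
open import Data.Nat using (ℕ; suc; _≤_; _<_; _+_; z≤n; s≤s; s≤s⁻¹; _<?_)
import Data.Nat as ℕ
open import Data.Nat.Properties
  using (≤-trans; ≤-refl; ≤-antisym; <-cmp; <-trans; <-irrefl; <-asym; <-≤-trans; ≤-<-trans;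
         ≤∧≢⇒<; 1+n≢n; +-suc; +-cancelʳ-≡; suc-injective)
open import Data.Product using (_×_; _,_; proj₁)
open import Data.Product.Properties using (≡-dec)
open import Data.Sum using (_⊎_; inj₁; inj₂; [_,_]′)
open import Relation.Binary using (tri<; tri≈; tri>)
open import Relation.Binary.Definitions using (DecidableEquality)
open import Relation.Binary.PropositionalEquality
  using (_≡_; _≢_; refl; sym; trans; cong; cong₂; subst; subst₂; module ≡-Reasoning)
open import Relation.Nullary using (¬_; yes; no; ¬?; _×-dec_)
open import Relation.Unary using (Decidable)

open import Defs

module _ {A B : Set} (_≟B_ : DecidableEquality B) {P : A → Set} (P? : Decidable P)
         (f : A → B) (g : B → A) (g∘f≡id : ∀ {x} → P x → g (f x) ≡ x) where

  -- Proof: remove f x from ws for each accepted x.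
  filter-≤-image : (xs : List A) (ws : List B) → Unique xs →
                   (∀ {x} → x ∈ xs → P x → f x ∈ ws) → length (filter P? xs) ≤ length ws
  filter-≤-image [] ws _ _ = z≤n
  filter-≤-image (x ∷ xs) ws (x∉xs ∷ xs!) into with P? x
  ... | no _ = filter-≤-image xs ws xs! λ y∈ → into (there y∈)
  ... | yes px = ≤-trans (s≤s rest≤) shorter
    where
    notFx : Decidable (f x ≢_)
    notFx w = ¬? (f x ≟B w)
    ws′ : List B
    ws′ = filter notFx ws
    shorter : length ws′ < length ws
    shorter = filter-notAll notFx ws (Any.map (λ fx≡w fx≢w → fx≢w fx≡w) (into (here refl) px))
    distinct : ∀ {y} → y ∈ xs → P y → f x ≢ f y
    distinct {y} y∈ py fx≡fy =
      lookup x∉xs y∈ (trans (sym (g∘f≡id px)) (trans (cong g fx≡fy) (g∘f≡id py)))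
    rest≤ : length (filter P? xs) ≤ length ws′
    rest≤ = filter-≤-image xs ws′ xs! λ y∈ py → ∈-filter⁺ notFx (into (there y∈) py) (distinct y∈ py)

count-≤-injection : ∀ {A B : Set} {P : A → Set} {Q : B → Set} (_≟B_ : DecidableEquality B)
  (P? : Decidable P) (Q? : Decidable Q) (f : A → B) (g : B → A) {xs : List A} {ys : List B} →
  Unique xs → (∀ y → y ∈ ys) → (∀ {x} → P x → Q (f x)) → (∀ {x} → P x → g (f x) ≡ x) →
  count P? xs ≤ count Q? ys
count-≤-injection _≟B_ P? Q? f g {xs} {ys} xs! ys-all PQ g∘f≡id =
  filter-≤-image _≟B_ P? f g g∘f≡id xs (filter Q? ys) xs! λ _ px → ∈-filter⁺ Q? (ys-all (f _)) (PQ px)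

count-≡-bijection : ∀ {A B : Set} {P : A → Set} {Q : B → Set}
  (_≟A_ : DecidableEquality A) (_≟B_ : DecidableEquality B)
  (P? : Decidable P) (Q? : Decidable Q) (f : A → B) (g : B → A) {xs : List A} {ys : List B} →
  Unique xs → (∀ x → x ∈ xs) → Unique ys → (∀ y → y ∈ ys) →
  (∀ {x} → P x → Q (f x)) → (∀ {y} → Q y → P (g y)) →
  (∀ {x} → P x → g (f x) ≡ x) → (∀ {y} → Q y → f (g y) ≡ y) →
  count P? xs ≡ count Q? ys
count-≡-bijection _≟A_ _≟B_ P? Q? f g xs! xs-all ys! ys-all PQ QP g∘f f∘g = ≤-antisym
  (count-≤-injection _≟B_ P? Q? f g xs! ys-all PQ g∘f)
  (count-≤-injection _≟A_ Q? P? g f ys! xs-all QP f∘g)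

count-disjoint-union : ∀ {A : Set} {R S T : A → Set}
  (R? : Decidable R) (S? : Decidable S) (T? : Decidable T) →
  (∀ {x} → T x → R x ⊎ S x) → (∀ {x} → R x → T x) → (∀ {x} → S x → T x) →
  (∀ {x} → R x → ¬ S x) → (xs : List A) → count R? xs + count S? xs ≡ count T? xs
count-disjoint-union R? S? T? split fromR fromS disjoint [] = refl
count-disjoint-union R? S? T? split fromR fromS disjoint (x ∷ xs)
  with ih ← count-disjoint-union R? S? T? split fromR fromS disjoint xs | R? x | S? x | T? x
... | yes r | yes s | _     = ⊥-elim (disjoint r s)
... | yes _ | no _  | yes _ = cong suc ih
... | yes r | no _  | no ¬t = ⊥-elim (¬t (fromR r))
... | no _  | yes _ | yes _ = trans (+-suc _ _) (cong suc ih)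
... | no _  | yes s | no ¬t = ⊥-elim (¬t (fromS s))
... | no ¬r | no ¬s | yes t = ⊥-elim ([ ¬r , ¬s ]′ (split t))
... | no _  | no _  | no _  = ih

pairs-complete : ∀ {n} (x : Fin n × Fin n) → x ∈ pairs n
pairs-complete (a , b) = ∈-cartesianProduct⁺ (∈-allFin a) (∈-allFin b)

pairs-unique : ∀ n → Unique (pairs n)
pairs-unique n = cartesianProduct⁺ (allFin⁺ n) (allFin⁺ n)

triples-complete : ∀ {n} (x : Fin n × Fin n × Fin n) → x ∈ triples n
triples-complete (a , bc) = ∈-cartesianProduct⁺ (∈-allFin a) (pairs-complete bc)

triples-unique : ∀ n → Unique (triples n)
triples-unique n = cartesianProduct⁺ (allFin⁺ n) (pairs-unique n)

pair-≟ : ∀ {n} → DecidableEquality (Fin n × Fin n)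
pair-≟ = ≡-dec _≟_ _≟_

triple-≟ : ∀ {n} → DecidableEquality (Fin n × Fin n × Fin n)
triple-≟ = ≡-dec _≟_ pair-≟

Adjacent : ∀ {n} → Fin n × Fin n → Set
Adjacent (j , k) = suc (toℕ j) ≡ toℕ k

Adjacent? : ∀ {n} → Decidable (Adjacent {n})
Adjacent? (j , k) = suc (toℕ j) ℕ.≟ toℕ k

adjacent⇒< : ∀ {n} {j k : Fin n} → Adjacent (j , k) → toℕ j < toℕ k
adjacent⇒< jk = subst (_ <_) jk ≤-refl

Ascent : ∀ {n} → (Fin n → ℕ) → Fin n × Fin n → Set
Ascent v (j , k) = Adjacent (j , k) × (v j < v k)

Ascent? : ∀ {n} (v : Fin n → ℕ) → Decidable (Ascent v)
Ascent? v (j , k) = Adjacent? (j , k) ×-dec (v j <? v k)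

Descent : ∀ {n} → (Fin n → ℕ) → Fin n × Fin n → Set
Descent v (j , k) = Adjacent (j , k) × (v k < v j)

ascents : ∀ {n} → Permutation′ n → ℕ
ascents {n} τ = count (Ascent? (val τ)) (pairs n)

suc-toℕ-pred : ∀ {n} (x : Fin n) → 0 < toℕ x → suc (toℕ (pred x)) ≡ toℕ x
suc-toℕ-pred (suc i) _ = cong suc (toℕ-inject₁ i)

pred-of-adjacent : ∀ {n} {j k : Fin n} → Adjacent (j , k) → pred k ≡ j
pred-of-adjacent {k = k} jk =
  toℕ-injective (suc-injective (trans (suc-toℕ-pred k (subst (0 <_) jk (s≤s z≤n))) (sym jk)))

val-at-position : ∀ {n} (τ : Permutation′ n) (x : Fin n) → val τ (τ ⟨$⟩ˡ x) ≡ toℕ x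
val-at-position τ x = cong toℕ (inverseʳ τ)

val-injective : ∀ {n} (τ : Permutation′ n) {x y : Fin n} → val τ x ≡ val τ y → x ≡ y
val-injective τ {x} {y} eq = begin
  x                     ≡⟨ sym (inverseˡ τ) ⟩
  τ ⟨$⟩ˡ (τ ⟨$⟩ʳ x)     ≡⟨ cong (τ ⟨$⟩ˡ_) (toℕ-injective eq) ⟩
  τ ⟨$⟩ˡ (τ ⟨$⟩ʳ y)     ≡⟨ inverseˡ τ ⟩
  y                     ∎
  where open ≡-Reasoning

-- 132 is an involution pattern, so the inverse of a 132-avoider avoids 132.
avoids132-inverse : ∀ {n} (π : Permutation′ n) → Avoids132 π → Avoids132 (flip π)
avoids132-inverse π avoids (i , j , k , i<j , j<k , πi<πk , πk<πj) =
  avoids (flip π ⟨$⟩ʳ i , flip π ⟨$⟩ʳ k , flip π ⟨$⟩ʳ j , πi<πk , πk<πj ,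
          subst₂ _<_ (sym (val-at-position π i)) (sym (val-at-position π j)) i<j ,
          subst₂ _<_ (sym (val-at-position π j)) (sym (val-at-position π k)) j<k)

ascentTop : ∀ {n} → Permutation′ n → Fin n × Fin n → Fin n × Fin n
ascentTop τ (j , k) = pred (τ ⟨$⟩ʳ k) , τ ⟨$⟩ʳ k

ascentTop-inverse : ∀ {n} (τ : Permutation′ n) {x : Fin n × Fin n} → Adjacent x →
                    ascentTop (flip τ) (ascentTop τ x) ≡ x
ascentTop-inverse τ {j , k} jk =
  cong₂ _,_ (trans (cong pred (inverseˡ τ)) (pred-of-adjacent jk)) (inverseˡ τ)

3-12↦23-1 : ∀ {n} → Permutation′ n → Fin n × Fin n × Fin n → Fin n × Fin n × Fin n
3-12↦23-1 τ (i , j , k) = pred (τ ⟨$⟩ʳ k) , τ ⟨$⟩ʳ k , τ ⟨$⟩ʳ i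

23-1↦3-12 : ∀ {n} → Permutation′ n → Fin n × Fin n × Fin n → Fin n × Fin n × Fin n
23-1↦3-12 τ (a , b , k) = τ ⟨$⟩ˡ k , ascentTop (flip τ) (a , b)

23-1↦3-12-inverse : ∀ {n} (τ : Permutation′ n) {i j k : Fin n} → Adjacent (j , k) →
                    23-1↦3-12 τ (3-12↦23-1 τ (i , j , k)) ≡ (i , j , k)
23-1↦3-12-inverse τ jk = cong₂ _,_ (inverseˡ τ) (ascentTop-inverse τ jk)

3-12↦23-1-inverse : ∀ {n} (τ : Permutation′ n) {a b k : Fin n} → Adjacent (a , b) →
                    3-12↦23-1 τ (23-1↦3-12 τ (a , b , k)) ≡ (a , b , k)
3-12↦23-1-inverse τ ab =
  cong₂ (λ (a , b) k → a , b , k) (ascentTop-inverse (flip τ) ab) (inverseʳ τ)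

module Avoider {n} (π : Permutation′ n) (avoids : Avoids132 π) where

  p : Fin n → ℕ
  p = val π
  position : Fin n → Fin n
  position = π ⟨$⟩ˡ_

  below : Fin n → Fin n
  below k = pred (π ⟨$⟩ʳ k)

  suc-below : ∀ {j k} → p j < p k → suc (toℕ (below k)) ≡ p k
  suc-below {k = k} pj<pk = suc-toℕ-pred (π ⟨$⟩ʳ k) (≤-<-trans z≤n pj<pk)

  below<top : ∀ {j k} → p j < p k → p (position (below k)) < p k
  below<top {k = k} pj<pk =
    subst₂ _<_ (sym (val-at-position π (below k))) (suc-below pj<pk) ≤-refl

  below-occurs-earlier : ∀ {j k} → Ascent p (j , k) → toℕ (position (below k)) < toℕ k
  below-occurs-earlier {j} {k} (jk , pj<pk) with <-cmp (toℕ (position (below k))) (toℕ k)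
  ... | tri< earlier _ _ = earlier
  ... | tri≈ _ same _ =
    ⊥-elim (<-irrefl (cong p (toℕ-injective same)) (below<top pj<pk))
  ... | tri> _ _ later = ⊥-elim (avoids (j , k , q , adjacent⇒< jk , later , pj<pq , below<top pj<pk))
    where
    q : Fin n
    q = position (below k)
    pj≤pq : p j ≤ p q
    pj≤pq = subst (p j ≤_) (sym (val-at-position π (below k)))
                  (s≤s⁻¹ (subst (p j <_) (sym (suc-below pj<pk)) pj<pk))
    pj≢pq : p j ≢ p q
    pj≢pq eq = <-irrefl (cong toℕ (val-injective π eq)) (<-trans (adjacent⇒< jk) later)
    pj<pq : p j < p q
    pj<pq = ≤∧≢⇒< pj≤pq pj≢pq

  below-occurs-after : ∀ {i j k} → toℕ i < toℕ j → Ascent p (j , k) → p k < p i →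
                       toℕ i < toℕ (position (below k))
  below-occurs-after {i} {j} {k} i<j (jk , pj<pk) pk<pi
    with <-cmp (toℕ (position (below k))) (toℕ i)
  ... | tri< q<i _ _ =
    ⊥-elim (avoids (position (below k) , i , k , q<i , <-trans i<j (adjacent⇒< jk) ,
                    below<top pj<pk , pk<pi))
  ... | tri≈ _ same _ =
    ⊥-elim (<-asym (subst (_< p k) (cong p (toℕ-injective same)) (below<top pj<pk)) pk<pi)
  ... | tri> _ _ i<q = i<q

  ascentTop-ascent : ∀ {x} → Ascent p x → Ascent (val (flip π)) (ascentTop π x)
  ascentTop-ascent {j , k} asc@(_ , pj<pk) =
    suc-below pj<pk ,
    subst (toℕ (position (below k)) <_) (sym (cong toℕ (inverseˡ π))) (below-occurs-earlier asc)

ascents-inverse : ∀ {n} (π : Permutation′ n) → Avoids132 π → ascents (flip π) ≡ ascents π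
ascents-inverse {n} π avoids =
  count-≡-bijection pair-≟ pair-≟ (Ascent? (val (flip π))) (Ascent? (val π))
    (ascentTop (flip π)) (ascentTop π) (pairs-unique n) pairs-complete (pairs-unique n) pairs-complete
    (Avoider.ascentTop-ascent (flip π) (avoids132-inverse π avoids))
    (Avoider.ascentTop-ascent π avoids)
    (λ asc → ascentTop-inverse (flip π) (proj₁ asc))
    (λ asc → ascentTop-inverse π (proj₁ asc))

des+ascents : ∀ {n} (τ : Permutation′ n) → des τ + ascents τ ≡ count (Adjacent? {n}) (pairs n)
des+ascents {n} τ = count-disjoint-union _ (Ascent? (val τ)) Adjacent? split proj₁ proj₁
  (λ (_ , desc) (_ , asc) → <-asym desc asc) (pairs n)
  where
  split : ∀ {x} → Adjacent x → Descent (val τ) x ⊎ Ascent (val τ) x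
  split {j , k} jk with <-cmp (val τ k) (val τ j)
  ... | tri< desc _ _ = inj₁ (jk , desc)
  ... | tri≈ _ same _ = ⊥-elim (1+n≢n (trans jk (cong toℕ (val-injective τ same))))
  ... | tri> _ _ asc  = inj₂ (jk , asc)

des-inverse : ∀ {n} (π : Permutation′ n) → Avoids132 π → des (flip π) ≡ des π
des-inverse {n} π avoids = +-cancelʳ-≡ _ (des (flip π)) (des π) (begin
  des (flip π) + ascents π         ≡⟨ cong (des (flip π) +_) (sym (ascents-inverse π avoids)) ⟩
  des (flip π) + ascents (flip π)  ≡⟨ des+ascents (flip π) ⟩
  count (Adjacent? {n}) (pairs n)  ≡⟨ sym (des+ascents π) ⟩
  des π + ascents π                ∎)
  where open ≡-Reasoning

Occurrence-3-12 : ∀ {n} → Permutation′ n → Fin n × Fin n × Fin n → Set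
Occurrence-3-12 τ (i , j , l) =
  (toℕ i < toℕ j) × Adjacent (j , l) × (val τ j < val τ l) × (val τ l < val τ i)

Occurrence-23-1 : ∀ {n} → Permutation′ n → Fin n × Fin n × Fin n → Set
Occurrence-23-1 τ (i , j , k) =
  Adjacent (i , j) × (toℕ j < toℕ k) × (val τ k < val τ i) × (val τ i < val τ j)

module Pattern-bijection {n} (π : Permutation′ n) (avoids : Avoids132 π) where
  open Avoider π avoids
  module Inverse = Avoider (flip π) (avoids132-inverse π avoids)

  3-12↦23-1-sound : ∀ {x} → Occurrence-3-12 π x → Occurrence-23-1 (flip π) (3-12↦23-1 π x)
  3-12↦23-1-sound {i , j , k} (i<j , jk , pj<pk , pk<pi) =
    let adj , top = ascentTop-ascent (jk , pj<pk) in
    adj , pk<pi ,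
    subst (_< toℕ (position (below k))) (sym (cong toℕ (inverseˡ π)))
          (below-occurs-after i<j (jk , pj<pk) pk<pi) ,
    top

  23-1↦3-12-sound : ∀ {x} → Occurrence-23-1 (flip π) x → Occurrence-3-12 π (23-1↦3-12 π x)
  23-1↦3-12-sound {a , b , k} (ab , b<k , sk<sa , sa<sb) =
    let adj , top = Inverse.ascentTop-ascent (ab , sa<sb) in
    <-≤-trans sk<sa (s≤s⁻¹ (subst (_ <_) (sym (Inverse.suc-below sa<sb)) sa<sb)) ,
    adj , top ,
    subst₂ _<_ (sym (val-at-position π b)) (sym (val-at-position π k)) b<k

E≡D-inverse : ∀ {n} (π : Permutation′ n) → Avoids132 π → E π ≡ D (flip π)
E≡D-inverse {n} π avoids =
  count-≡-bijection triple-≟ triple-≟ _ _ (3-12↦23-1 π) (23-1↦3-12 π)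
    (triples-unique n) triples-complete (triples-unique n) triples-complete
    3-12↦23-1-sound 23-1↦3-12-sound
    (λ { {_ , _ , _} (_ , jk , _) → 23-1↦3-12-inverse π jk })
    (λ { {_ , _ , _} (ab , _) → 3-12↦23-1-inverse π ab })
  where open Pattern-bijection π avoids

proposition3 : (n : ℕ) (π : Permutation′ n) → Avoids132 π →
    (D (flip π) , E (flip π) , des (flip π)) ≡ (E π , D π , des π)
proposition3 n π avoids = cong₂ _,_ D-inverse (cong₂ _,_ E-inverse (des-inverse π avoids))
  where
  D-inverse : D (flip π) ≡ E π
  D-inverse = sym (E≡D-inverse π avoids)
  -- π⁻¹ is again 132-avoiding, and (π⁻¹)⁻¹ is π.
  E-inverse : E (flip π) ≡ D π
  E-inverse = E≡D-inverse (flip π) (avoids132-inverse π avoids)
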